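{- For all modal trees $\mathtt{T},\mathtt{T}'$: if $\mathtt{T}\hookrightarrow^{*}\mathtt{T}'$ in the tree rewriting system $\mathsf{TRC}$, then $\mathscr{F}(\mathtt{T})\vdash_{\mathbf{RC}}\mathscr{F}(\mathtt{T}')$.
   Context: Strictly positive formulas $\mathcal{L}^+$: $\varphi::=\top\mid p\mid\langle\alpha\rangle\varphi\mid(\varphi\wedge\varphi)$ with $p$ a propositional variable and $\alpha<\omega$. Sequents $\varphi\vdash\psi$. $\mathbf{K}^+$ has axioms $\varphi\vdash\varphi$, $\varphi\vdash\top$, $\varphi\wedge\psi\vdash\varphi$, $\varphi\wedge\psi\vdash\psi$, and rules: from $\varphi\vdash\psi$ and $\psi\vdash\chi$ infer $\varphi\vdash\chi$; from $\varphi\vdash\psi$ and $\varphi\vdash\chi$ infer $\varphi\vdash\psi\wedge\chi$; from $\varphi\vdash\psi$ infer $\langle\alpha\rangle\varphi\vdash\langle\alpha\rangle\psi$. The Reflection Calculus $\mathbf{RC}$ extends $\mathbf{K}^+$ by axioms $\langle\alpha\rangle\langle\alpha\rangle\varphi\vdash\langle\alpha\rangle\varphi$; $\langle\alpha\rangle\varphi\vdash\langle\beta\rangle\varphi$ for $\alpha>\beta$; $\langle\alpha\rangle\varphi\wedge\langle\beta\rangle\psi\vdash\langle\alpha\rangle(\varphi\wedge\langle\beta\rangle\psi)$ for $\alpha>\beta$. Modal trees: recursively, pairs $\langle\Delta;\Gamma\rangle$ with $\Delta$ a finite list of propositional variables and $\Gamma$ a finite list of pairs $(\alpha,\mathtt{S})$,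 $\alpha<\omega$, $\mathtt{S}$ a modal tree. For a finite list $\Pi$ of formulas, $\bigwedge\varnothing=\top$ and $\bigwedge(\varphi\frown\Pi)=\varphi\wedge\bigwedge\Pi$. $\mathscr{F}(\langle\Delta;\Gamma\rangle):=\bigwedge\Delta\wedge\bigwedge[\langle\alpha\rangle\mathscr{F}(\mathtt{S})\mid(\alpha,\mathtt{S})\in\Gamma]$. Positions: $\mathrm{Pos}(\langle\Delta;\varnothing\rangle)=\{\epsilon\}$; $\mathrm{Pos}(\langle\Delta;[(\alpha_1,\mathtt{S}_1),\dots,(\alpha_n,\mathtt{S}_n)]\rangle)=\{\epsilon\}\cup\bigcup_{i=1}^n\{i\mathbf{k}\mid\mathbf{k}\in\mathrm{Pos}(\mathtt{S}_i)\}$. Subtree: $\mathtt{T}|_\epsilon=\mathtt{T}$, $\mathtt{T}|_{i\mathbf{r}}=\mathtt{S}_i|_{\mathbf{r}}$. Replacement: $\mathtt{T}[\mathtt{S}]_\epsilon=\mathtt{S}$, $\mathtt{T}[\mathtt{S}]_{i\mathbf{r}}$ is $\mathtt{T}$ with its $i$-th child $\mathtt{S}_i$ replaced by $\mathtt{S}_i[\mathtt{S}]_{\mathbf{r}}$ (same edge label). List operations, for $\Gamma$ a list and $0<i,j\le|\Gamma|$: $\#_i\Gamma$ is the $i$-th element; $\Gamma^{ -i}$ deletes it; $\Gamma^{+i}=(\#_i\Gamma)\frown\Gamma$; $\Gamma[x]_i$ replaces the $i$-th element by $x$; $\Gamma^{i\leftrightarrow j}$ swaps the $i$-th and $j$-th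 elements; similarly $\Delta^{ -n},\Delta^{+n}$ for node labels. $\mathsf{TRC}$ rules: for a modal tree $\mathtt{T}$, $\mathbf{k}\in\mathrm{Pos}(\mathtt{T})$ with $\mathtt{T}|_\mathbf{k}=\langle\Delta;\Gamma\rangle$: ($\rho^+$) $\mathtt{T}\hookrightarrow\mathtt{T}[\langle\Delta^{+i};\Gamma\rangle]_\mathbf{k}$, $0<i\le|\Delta|$; ($\rho^-$) $\mathtt{T}\hookrightarrow\mathtt{T}[\langle\Delta^{ -i};\Gamma\rangle]_\mathbf{k}$; ($\sigma$) $\mathtt{T}\hookrightarrow\mathtt{T}[\langle\Delta;\Gamma^{i\leftrightarrow j}\rangle]_\mathbf{k}$, $i\neq j$; ($\pi^+$) $\mathtt{T}\hookrightarrow\mathtt{T}[\langle\Delta;\Gamma^{+i}\rangle]_\mathbf{k}$; ($\pi^-$) $\mathtt{T}\hookrightarrow\mathtt{T}[\langle\Delta;\Gamma^{ -i}\rangle]_\mathbf{k}$; ($\mathfrak{4}$) if $\#_i\Gamma=(\beta,\langle\tilde\Delta;\tilde\Gamma\rangle)$ and $\#_j\tilde\Gamma=(\beta,\mathtt{S})$, then $\mathtt{T}\hookrightarrow\mathtt{T}[\langle\Delta;\Gamma[(\beta,\mathtt{S})]_i\rangle]_\mathbf{k}$; ($\lambda$) if $\#_i\Gamma=(\alpha,\mathtt{S})$ and $\alpha>\beta$, then $\mathtt{T}\hookrightarrow\mathtt{T}[\langle\Delta;\Gamma[(\beta,\mathtt{S})]_i\rangle]_\mathbf{k}$; ($\mathsf{J}$)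 if $i\ne j$, $\#_i\Gamma=(\alpha,\langle\tilde\Delta;\tilde\Gamma\rangle)$, $\#_j\Gamma=(\beta,\mathtt{S})$, $\alpha>\beta$, then $\mathtt{T}\hookrightarrow\mathtt{T}[\langle\Delta;(\Gamma[(\alpha,\langle\tilde\Delta;\tilde\Gamma\frown(\beta,\mathtt{S})\rangle)]_i)^{ -j}\rangle]_\mathbf{k}$. $\hookrightarrow$ is the union of these relations and $\hookrightarrow^*$ its reflexive-transitive closure. -}

module Defs where

open import Data.Nat using (ℕ; zero; suc; _<_; _>_)
open import Data.Fin using (Fin; zero; suc; cast)
open import Data.List using (List; []; _∷_; length; lookup; removeAt; _++_; [_])
open import Data.Product using (_×_; _,_; proj₁; proj₂)
open import Data.Maybe using (Maybe; just; nothing)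
open import Relation.Binary.PropositionalEquality using (_≡_; _≢_; refl; cong; sym)
open import Relation.Binary.Construct.Closure.ReflexiveTransitive using (Star)

data Formula : Set where
  ⊤′  : Formula
  var : ℕ → Formula
  ⟨_⟩_ : ℕ → Formula → Formula
  _∧_ : Formula → Formula → Formula

infixr 6 _∧_
infix 4 _⊢_

data _⊢_ : Formula → Formula → Set where
  ax-id   : ∀ {φ} → φ ⊢ φ
  ax-top  : ∀ {φ} → φ ⊢ ⊤′
  ax-∧l   : ∀ {φ ψ} → φ ∧ ψ ⊢ φ
  ax-∧r   : ∀ {φ ψ} → φ ∧ ψ ⊢ ψ
  cut     : ∀ {φ ψ χ} → φ ⊢ ψ → ψ ⊢ χ → φ ⊢ χ
  ∧-intro : ∀ {φ ψ χ} → φ ⊢ ψ → φ ⊢ χ → φ ⊢ ψ ∧ χ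
  nec     : ∀ {α φ ψ} → φ ⊢ ψ → ⟨ α ⟩ φ ⊢ ⟨ α ⟩ ψ
  ax-trans : ∀ {α φ} → ⟨ α ⟩ ⟨ α ⟩ φ ⊢ ⟨ α ⟩ φ
  ax-mono  : ∀ {α β φ} → α > β → ⟨ α ⟩ φ ⊢ ⟨ β ⟩ φ
  ax-J     : ∀ {α β φ ψ} → α > β →
             (⟨ α ⟩ φ) ∧ (⟨ β ⟩ ψ) ⊢ ⟨ α ⟩ (φ ∧ ⟨ β ⟩ ψ)

data Tree : Set where
  node : List ℕ → List (ℕ × Tree) → Tree

⋀ : List Formula → Formula
⋀ []      = ⊤′
⋀ (φ ∷ Π) = φ ∧ ⋀ Π

mutual
  𝔽 : Tree → Formula
  𝔽 (node Δ Γ) = ⋀ (vars Δ) ∧ ⋀ (diamonds Γ)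

  vars : List ℕ → List Formula
  vars []      = []
  vars (p ∷ Δ) = var p ∷ vars Δ

  diamonds : List (ℕ × Tree) → List Formula
  diamonds []            = []
  diamonds ((α , S) ∷ Γ) = (⟨ α ⟩ 𝔽 S) ∷ diamonds Γ

-- Positions (lists of 1-based child indices), subtrees, replacement.
-- Partial operations return Maybe; a position k is in Pos(T) iff T ∣ k ≡ just _.

Position : Set
Position = List ℕ

mutual
  _∣_ : Tree → Position → Maybe Tree
  T ∣ [] = just T
  node Δ Γ ∣ (i ∷ r) = childSub Γ i r

  childSub : List (ℕ × Tree) → ℕ → Position → Maybe Tree
  childSub []            i             r = nothing
  childSub (x ∷ Γ)       zero          r = nothing
  childSub ((α , S) ∷ Γ) (suc zero)    r = S ∣ r
  childSub (x ∷ Γ)       (suc (suc i)) r = childSub Γ (suc i) r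

mutual
  -- T [ S ]at k  (only meaningful when k ∈ Pos(T))
  _[_]at_ : Tree → Tree → Position → Tree
  T [ S ]at [] = S
  node Δ Γ [ S ]at (i ∷ r) = node Δ (childRep Γ S i r)

  childRep : List (ℕ × Tree) → Tree → ℕ → Position → List (ℕ × Tree)
  childRep []             S i             r = []
  childRep (x ∷ Γ)        S zero          r = x ∷ Γ
  childRep ((α , U) ∷ Γ)  S (suc zero)    r = (α , U [ S ]at r) ∷ Γ
  childRep (x ∷ Γ)        S (suc (suc i)) r = x ∷ childRep Γ S (suc i) r

-- List operations (indices given as Fin (length Γ), i.e. 0-based,
-- standing for the paper's 1-based 0 < i ≤ |Γ|)

module _ {A : Set} where
  nth : (xs : List A) → Fin (length xs) → A
  nth = lookup

  del : (xs : List A) → Fin (length xs) → List A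
  del = removeAt

  dup : (xs : List A) → Fin (length xs) → List A
  dup xs i = lookup xs i ∷ xs

  set : (xs : List A) → Fin (length xs) → A → List A
  set (x ∷ xs) zero    a = a ∷ xs
  set (x ∷ xs) (suc i) a = x ∷ set xs i a

  length-set : (xs : List A) (i : Fin (length xs)) (a : A) →
               length (set xs i a) ≡ length xs
  length-set (x ∷ xs) zero    a = refl
  length-set (x ∷ xs) (suc i) a = cong suc (length-set xs i a)

  reindex : (xs : List A) (i : Fin (length xs)) (a : A) →
            Fin (length xs) → Fin (length (set xs i a))
  reindex xs i a j = cast (sym (length-set xs i a)) j

  swap : (xs : List A) → Fin (length xs) → Fin (length xs) → List A
  swap []       ()      _
  swap (x ∷ xs) zero    zero    = x ∷ xs
  swap (x ∷ xs) (suc i) (suc j) = x ∷ swap xs i j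
  swap (x ∷ xs) zero    (suc j) = lookup xs j ∷ set xs j x
  swap (x ∷ xs) (suc i) zero    = lookup xs i ∷ set xs i x

data _⇝_ : Tree → Tree → Set where
  ρ⁺ : ∀ {Δ Γ} (i : Fin (length Δ)) → node Δ Γ ⇝ node (dup Δ i) Γ
  ρ⁻ : ∀ {Δ Γ} (i : Fin (length Δ)) → node Δ Γ ⇝ node (del Δ i) Γ
  σ  : ∀ {Δ Γ} (i j : Fin (length Γ)) → i ≢ j → node Δ Γ ⇝ node Δ (swap Γ i j)
  π⁺ : ∀ {Δ Γ} (i : Fin (length Γ)) → node Δ Γ ⇝ node Δ (dup Γ i)
  π⁻ : ∀ {Δ Γ} (i : Fin (length Γ)) → node Δ Γ ⇝ node Δ (del Γ i)
  r4 : ∀ {Δ Γ β Δ̃ Γ̃ S} (i : Fin (length Γ)) → nth Γ i ≡ (β , node Δ̃ Γ̃) →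
       (j : Fin (length Γ̃)) → nth Γ̃ j ≡ (β , S) →
       node Δ Γ ⇝ node Δ (set Γ i (β , S))
  λr : ∀ {Δ Γ α β S} (i : Fin (length Γ)) → nth Γ i ≡ (α , S) → α > β →
       node Δ Γ ⇝ node Δ (set Γ i (β , S))
  Jr : ∀ {Δ Γ α β Δ̃ Γ̃ S} (i j : Fin (length Γ)) → i ≢ j →
       nth Γ i ≡ (α , node Δ̃ Γ̃) → nth Γ j ≡ (β , S) → α > β →
       node Δ Γ ⇝ node Δ (removeAt (set Γ i (α , node Δ̃ (Γ̃ ++ [ (β , S) ])))
                           (reindex Γ i (α , node Δ̃ (Γ̃ ++ [ (β , S) ])) j))

data _↪_ : Tree → Tree → Set where
  step : ∀ {T U U′} (k : Position) → T ∣ k ≡ just U → U ⇝ U′ → T ↪ (T [ U′ ]at k)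

_↪*_ : Tree → Tree → Set
_↪*_ = Star _↪_

{-# OPTIONS --safe #-}
module Submission where

-- 𝔽 of a node is a conjunction, so the rules that only duplicate, delete or
-- permute labels or children (ρ±, σ, π±) are sound by weakening within a
-- conjunction.  The rules 4, λ and J replace a child by one whose diamond follows
-- from diamonds already among the conjuncts, by the RC axioms of transitivity,
-- monotonicity and J respectively.  Finally 𝔽 is monotone in every subtree,
-- because ∧ and ⟨α⟩ are.

open import Defs
open import Data.Nat using (ℕ; zero; suc)
open import Data.Fin using (Fin; zero; suc)
open import Data.List using (List; []; _∷_; length; map; _++_; [_])
open import Data.List.Relation.Unary.Any using (here; there)
open import Data.List.Membership.Propositional using (_∈_)
open import Data.List.Membership.Propositional.Properties using (∈-lookup; ∈-map⁺)
open import Data.List.Relation.Binary.Subset.Propositional using (_⊆_)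
open import Data.List.Relation.Binary.Subset.Propositional.Properties
  using (⊆-refl; ⊆-trans; ⊆-reflexive-↭; xs⊆x∷xs; ∷⁺ʳ; ∈-∷⁺ʳ; map⁺)
open import Data.List.Relation.Binary.Permutation.Propositional using (↭-sym)
open import Data.List.Relation.Binary.Permutation.Propositional.Properties using (∷↭∷ʳ)
open import Data.Product using (_×_; _,_)
open import Data.Maybe using (just)
open import Function using (_∘_)
open import Relation.Binary.Bundles using (Preorder)
open import Relation.Binary.PropositionalEquality
  using (_≡_; refl; cong; subst; subst₂; sym; isEquivalence)
open import Relation.Binary.Construct.Closure.ReflexiveTransitive using (ε; _◅_)

⊢-preorder : Preorder _ _ _
⊢-preorder = record
  { Carrier    = Formula
  ; _≈_        = _≡_
  ; _≲_        = _⊢_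
  ; isPreorder = record
    { isEquivalence = isEquivalence
    ; reflexive     = λ { refl → ax-id }
    ; trans         = cut
    }
  }

open import Relation.Binary.Reasoning.Preorder ⊢-preorder

∧-mono : ∀ {φ φ′ ψ ψ′} → φ ⊢ φ′ → ψ ⊢ ψ′ → φ ∧ ψ ⊢ φ′ ∧ ψ′
∧-mono h k = ∧-intro (cut ax-∧l h) (cut ax-∧r k)

⋀-∈ : ∀ {φ Φ} → φ ∈ Φ → ⋀ Φ ⊢ φ
⋀-∈ (here refl) = ax-∧l
⋀-∈ (there p)   = cut ax-∧r (⋀-∈ p)

⋀-intro : ∀ {ψ} Φ → (∀ {φ} → φ ∈ Φ → ψ ⊢ φ) → ψ ⊢ ⋀ Φ
⋀-intro []      h = ax-top
⋀-intro (φ ∷ Φ) h = ∧-intro (h (here refl)) (⋀-intro Φ (h ∘ there))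

⋀-antitone : ∀ {Φ Ψ} → Ψ ⊆ Φ → ⋀ Φ ⊢ ⋀ Ψ
⋀-antitone {Ψ = Ψ} Ψ⊆Φ = ⋀-intro Ψ (⋀-∈ ∘ Ψ⊆Φ)

module _ {A : Set} where

  set-⊆ : (xs : List A) (i : Fin (length xs)) (a : A) → set xs i a ⊆ a ∷ xs
  set-⊆ (x ∷ xs) zero    a = ∷⁺ʳ a (xs⊆x∷xs xs x)
  set-⊆ (x ∷ xs) (suc i) a =
    ∈-∷⁺ʳ (there (here refl)) (⊆-trans (set-⊆ xs i a) (∷⁺ʳ a (xs⊆x∷xs xs x)))

  swap-⊆ : (xs : List A) (i j : Fin (length xs)) → swap xs i j ⊆ xs
  swap-⊆ (x ∷ xs) zero    zero    = ⊆-refl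
  swap-⊆ (x ∷ xs) (suc i) (suc j) = ∷⁺ʳ x (swap-⊆ xs i j)
  swap-⊆ (x ∷ xs) zero    (suc j) = ∈-∷⁺ʳ (there (∈-lookup j)) (set-⊆ xs j x)
  swap-⊆ (x ∷ xs) (suc i) zero    = ∈-∷⁺ʳ (there (∈-lookup i)) (set-⊆ xs i x)

  removeAt-⊆ : (xs : List A) (i : Fin (length xs)) → del xs i ⊆ xs
  removeAt-⊆ (x ∷ xs) zero    = xs⊆x∷xs xs x
  removeAt-⊆ (x ∷ xs) (suc i) = ∷⁺ʳ x (removeAt-⊆ xs i)

  dup-⊆ : (xs : List A) (i : Fin (length xs)) → dup xs i ⊆ xs
  dup-⊆ xs i = ∈-∷⁺ʳ (∈-lookup i) ⊆-refl

  snoc-⊆ : (xs : List A) (x : A) → xs ++ [ x ] ⊆ x ∷ xs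
  snoc-⊆ xs x = ⊆-reflexive-↭ (↭-sym (∷↭∷ʳ x xs))

  nth-∈ : ∀ {x} (xs : List A) (i : Fin (length xs)) → nth xs i ≡ x → x ∈ xs
  nth-∈ xs i refl = ∈-lookup i

diamond : ℕ × Tree → Formula
diamond (α , S) = ⟨ α ⟩ 𝔽 S

vars-map : ∀ Δ → vars Δ ≡ map var Δ
vars-map []      = refl
vars-map (p ∷ Δ) = cong (var p ∷_) (vars-map Δ)

diamonds-map : ∀ Γ → diamonds Γ ≡ map diamond Γ
diamonds-map []            = refl
diamonds-map ((α , S) ∷ Γ) = cong (⟨ α ⟩ 𝔽 S ∷_) (diamonds-map Γ)

vars-⊆ : ∀ {Δ Δ′} → Δ′ ⊆ Δ → vars Δ′ ⊆ vars Δ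
vars-⊆ {Δ} {Δ′} h = subst₂ _⊆_ (sym (vars-map Δ′)) (sym (vars-map Δ)) (map⁺ var h)

diamonds-⊆ : ∀ {Γ Γ′} → Γ′ ⊆ Γ → diamonds Γ′ ⊆ diamonds Γ
diamonds-⊆ {Γ} {Γ′} h =
  subst₂ _⊆_ (sym (diamonds-map Γ′)) (sym (diamonds-map Γ)) (map⁺ diamond h)

node-⊆ : ∀ {Δ Δ′ Γ Γ′} → Δ′ ⊆ Δ → Γ′ ⊆ Γ → 𝔽 (node Δ Γ) ⊢ 𝔽 (node Δ′ Γ′)
node-⊆ Δ′⊆Δ Γ′⊆Γ = ∧-mono (⋀-antitone (vars-⊆ Δ′⊆Δ)) (⋀-antitone (diamonds-⊆ Γ′⊆Γ))

node-∈ : ∀ {Δ Γ α S} → (α , S) ∈ Γ → 𝔽 (node Δ Γ) ⊢ ⟨ α ⟩ 𝔽 S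
node-∈ {Γ = Γ} p = cut ax-∧r (⋀-∈ (subst (_ ∈_) (sym (diamonds-map Γ)) (∈-map⁺ diamond p)))

node-adjoin : ∀ {Δ Γ α S} → 𝔽 (node Δ Γ) ∧ ⟨ α ⟩ 𝔽 S ⊢ 𝔽 (node Δ ((α , S) ∷ Γ))
node-adjoin = ∧-intro (cut ax-∧l ax-∧l) (∧-intro ax-∧r (cut ax-∧l ax-∧r))

node-set : ∀ {Δ Γ β S} (i : Fin (length Γ)) → 𝔽 (node Δ Γ) ⊢ ⟨ β ⟩ 𝔽 S →
           𝔽 (node Δ Γ) ⊢ 𝔽 (node Δ (set Γ i (β , S)))
node-set {Γ = Γ} i h =
  cut (∧-intro ax-id h) (cut node-adjoin (node-⊆ ⊆-refl (set-⊆ Γ i _)))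

⇝-sound : ∀ {U U′} → U ⇝ U′ → 𝔽 U ⊢ 𝔽 U′
⇝-sound (ρ⁺ {Δ} i)        = node-⊆ (dup-⊆ Δ i) ⊆-refl
⇝-sound (ρ⁻ {Δ} i)        = node-⊆ (removeAt-⊆ Δ i) ⊆-refl
⇝-sound (σ {Γ = Γ} i j _) = node-⊆ ⊆-refl (swap-⊆ Γ i j)
⇝-sound (π⁺ {Γ = Γ} i)    = node-⊆ ⊆-refl (dup-⊆ Γ i)
⇝-sound (π⁻ {Γ = Γ} i)    = node-⊆ ⊆-refl (removeAt-⊆ Γ i)
⇝-sound (r4 {Δ} {Γ} {β} {Δ̃} {Γ̃} {S} i eᵢ j eⱼ) = node-set i (begin
  𝔽 (node Δ Γ)        ≲⟨ node-∈ (nth-∈ Γ i eᵢ) ⟩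
  ⟨ β ⟩ 𝔽 (node Δ̃ Γ̃)   ≲⟨ nec (node-∈ (nth-∈ Γ̃ j eⱼ)) ⟩
  ⟨ β ⟩ ⟨ β ⟩ 𝔽 S      ≲⟨ ax-trans ⟩
  ⟨ β ⟩ 𝔽 S            ∎)
⇝-sound (λr {Γ = Γ} i e α>β) = node-set i (cut (node-∈ (nth-∈ Γ i e)) (ax-mono α>β))
⇝-sound (Jr {Δ} {Γ} {α} {β} {Δ̃} {Γ̃} {S} i j _ eᵢ eⱼ α>β) =
  cut (node-set i joined) (node-⊆ ⊆-refl (removeAt-⊆ _ _))
  where
  joined : 𝔽 (node Δ Γ) ⊢ ⟨ α ⟩ 𝔽 (node Δ̃ (Γ̃ ++ [ (β , S) ]))
  joined = begin
    𝔽 (node Δ Γ)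
      ≲⟨ ∧-intro (node-∈ (nth-∈ Γ i eᵢ)) (node-∈ (nth-∈ Γ j eⱼ)) ⟩
    ⟨ α ⟩ 𝔽 (node Δ̃ Γ̃) ∧ ⟨ β ⟩ 𝔽 S     ≲⟨ ax-J α>β ⟩
    ⟨ α ⟩ (𝔽 (node Δ̃ Γ̃) ∧ ⟨ β ⟩ 𝔽 S)   ≲⟨ nec node-adjoin ⟩
    ⟨ α ⟩ 𝔽 (node Δ̃ ((β , S) ∷ Γ̃))    ≲⟨ nec (node-⊆ ⊆-refl (snoc-⊆ Γ̃ _)) ⟩
    ⟨ α ⟩ 𝔽 (node Δ̃ (Γ̃ ++ [ (β , S) ])) ∎

mutual
  []at-mono : ∀ T k {U U′} → T ∣ k ≡ just U → 𝔽 U ⊢ 𝔽 U′ → 𝔽 T ⊢ 𝔽 (T [ U′ ]at k)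
  []at-mono T          []      refl h = h
  []at-mono (node Δ Γ) (i ∷ r) e    h = ∧-mono ax-id (childRep-mono Γ i r e h)

  childRep-mono : ∀ Γ i r {U U′} → childSub Γ i r ≡ just U → 𝔽 U ⊢ 𝔽 U′ →
                  ⋀ (diamonds Γ) ⊢ ⋀ (diamonds (childRep Γ U′ i r))
  childRep-mono ((α , S) ∷ Γ) (suc zero)    r e h = ∧-mono (nec ([]at-mono S r e h)) ax-id
  childRep-mono (x ∷ Γ)       (suc (suc i)) r e h = ∧-mono ax-id (childRep-mono Γ (suc i) r e h)

↪-sound : ∀ {T T′} → T ↪ T′ → 𝔽 T ⊢ 𝔽 T′
↪-sound (step {T} k e u) = []at-mono T k e (⇝-sound u)

mainTheorem1 : ∀ (T T′ : Tree) → T ↪* T′ → 𝔽 T ⊢ 𝔽 T′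
mainTheorem1 T .T ε        = ax-id
mainTheorem1 T T′ (s ◅ ss) = cut (↪-sound s) (mainTheorem1 _ T′ ss)
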